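{- For all positive integers $k$ and $n$, $$c_{2k}(n,2)\leq \frac{\binom{n}{k}}{\frac{1}{2}\binom{2k}{k}}.$$
   Context: A family $\mathcal F$ of sets is 2-cancellative if for all four distinct members $A_1,A_2,B,C\in\mathcal F$ we have $A_1\cup A_2\cup B\neq A_1\cup A_2\cup C$. $c_r(n,2)$ denotes the maximum size of a 2-cancellative family of $r$-element subsets of $[n]=\{1,\dots,n\}$. -}

module Defs where

open import Data.Nat using (ℕ)
open import Data.Fin.Subset using (Subset; _∪_)
open import Data.List using (List)
open import Data.List.Membership.Propositional using (_∈_)
open import Data.List.Relation.Unary.Unique.Propositional using (Unique)
open import Data.List.Relation.Unary.All using (All)
open import Relation.Binary.PropositionalEquality using (_≡_; _≢_)
open import Data.Fin.Subset using (∣_∣)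

-- A family of subsets of [n], represented as a duplicate-free list.

TwoCancellative : {n : ℕ} → List (Subset n) → Set
TwoCancellative F =
  ∀ A₁ A₂ B C → A₁ ∈ F → A₂ ∈ F → B ∈ F → C ∈ F →
  A₁ ≢ A₂ → A₁ ≢ B → A₁ ≢ C → A₂ ≢ B → A₂ ≢ C → B ≢ C →
  (A₁ ∪ A₂) ∪ B ≢ (A₁ ∪ A₂) ∪ C

Uniform : {n : ℕ} → ℕ → List (Subset n) → Set
Uniform r F = All (λ A → ∣ A ∣ ≡ r) F

module Submission where

-- Let F be a 2-cancellative family of 2K-subsets of
-- [n] and, for V ⊆ [n], let deg V be the number of members of F containing V.
-- A K-subset V of A ∈ F is a "half" of A; the halves of A come in
-- complementary pairs {V, A∖V}.  Every pair carries total weight 2, split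
-- between its two halves by a rule 'share' depending only on their degrees,
-- so each A ∈ F hands out exactly C(2K,K) (weight-total).  Conversely every
-- K-set V receives at most 2 (received).  The key point is that at most two
-- members A ⊇ V are "heavy", i.e. have A∖V inside a second member of F, since
-- three heavy members would contradict 2-cancellativity (at-most-two-heavy).
-- Counting the total weight both ways gives |F| · C(2K,K) ≤ 2 · C(n,K)
-- (cancellative-bound), of which theorem5 is the instance K = k+1.
--
-- Sets are Boolean vectors (Subset n) and A∖V is computed as V ⊕ A (symmetric
-- difference), an involution of the whole cube, so sums over all V ∈ {0,1}ⁿ
-- are invariant under V ↦ V ⊕ A.

open import Defs
open import Data.Bool using (Bool; true; false; _∧_; _∨_; not; T; _xor_)
open import Data.Bool.Properties using (∧-zeroʳ; ∧-identityʳ; T-∧; T-≡; ⇔→≡)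
import Data.Bool as Bool
open import Data.Empty using (⊥; ⊥-elim)
open import Data.Fin.Subset using (Subset; _∪_; ∣_∣; ⊤)
open import Data.Fin.Subset.Properties using (∪-comm; ∣⊤∣≡n)
open import Data.List using (List; []; _∷_; length)
open import Data.List.Membership.Propositional using (_∈_)
open import Data.List.Relation.Unary.All as All using (All; []; _∷_)
open import Data.List.Relation.Unary.Any using (here; there)
open import Data.List.Relation.Unary.AllPairs using (_∷_)
open import Data.List.Relation.Unary.Unique.Propositional using (Unique)
open import Data.Nat using (ℕ; zero; suc; _+_; _*_; _≤_; _≤?_; _≡ᵇ_; z≤n; s≤s)
open import Data.Nat.Combinatorics using (_C_; nCk+nC[k+1]≡[n+1]C[k+1])
open import Data.Nat.Properties
open import Algebra.Properties.CommutativeSemigroup +-commutativeSemigroup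
  using () renaming (interchange to +-interchange)
open import Data.Product using (Σ; _×_; _,_; proj₁; proj₂)
open import Data.Vec using ([]; _∷_; zipWith)
open import Data.Vec.Properties using (≡-dec)
open import Function using (_∘_; Equivalence; mk⇔)
open import Relation.Binary.Definitions using (DecidableEquality)
open import Relation.Binary.PropositionalEquality
open import Relation.Nullary using (yes; no; does)

private
  variable
    n : ℕ
    E : Set

bit : Bool → ℕ
bit true  = 1
bit false = 0

bit-∧ : ∀ a b → bit a * bit b ≡ bit (a ∧ b)
bit-∧ true  b = +-identityʳ (bit b)
bit-∧ false b = refl

∧-left : ∀ {x y} → T (x ∧ y) → T x
∧-left = proj₁ ∘ Equivalence.to T-∧

∧-right : ∀ {x y} → T (x ∧ y) → T y
∧-right = proj₂ ∘ Equivalence.to T-∧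

∧-intro : ∀ {x y} → T x → T y → T (x ∧ y)
∧-intro p q = Equivalence.from T-∧ (p , q)

T-ext : ∀ {x y} → (T x → T y) → (T y → T x) → x ≡ y
T-ext f g = ⇔→≡ (mk⇔ (Equivalence.to T-≡ ∘ f ∘ Equivalence.from T-≡)
                     (Equivalence.to T-≡ ∘ g ∘ Equivalence.from T-≡))

≢1⇒2≤ : ∀ m → T (not (m ≡ᵇ 1)) → 1 ≤ m → 2 ≤ m
≢1⇒2≤ (suc (suc m)) _ _ = s≤s (s≤s z≤n)

listSum : (E → ℕ) → List E → ℕ
listSum f []       = 0
listSum f (x ∷ xs) = f x + listSum f xs

count : (E → Bool) → List E → ℕ
count p = listSum (λ x → bit (p x))

listSum-mono : {f h : E → ℕ} → (∀ x → f x ≤ h x) → (L : List E) →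
               listSum f L ≤ listSum h L
listSum-mono f≤h []       = z≤n
listSum-mono f≤h (x ∷ L) = +-mono-≤ (f≤h x) (listSum-mono f≤h L)

listSum-scale : (c : ℕ) (f : E → ℕ) (L : List E) →
                listSum (λ x → c * f x) L ≡ c * listSum f L
listSum-scale c f []       = sym (*-zeroʳ c)
listSum-scale c f (x ∷ L) =
  trans (cong (c * f x +_) (listSum-scale c f L)) (sym (*-distribˡ-+ c (f x) _))

listSum-zero : (L : List E) → listSum (λ _ → 0) L ≡ 0
listSum-zero []       = refl
listSum-zero (x ∷ L) = listSum-zero L

listSum-const : {f : E → ℕ} {c : ℕ} (L : List E) → All (λ x → f x ≡ c) L →
                listSum f L ≡ length L * c
listSum-const []       []         = refl
listSum-const (x ∷ L) (fx≡c ∷ al) = cong₂ _+_ fx≡c (listSum-const L al)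

cubeSum : {n : ℕ} → (Subset n → ℕ) → ℕ
cubeSum {zero}  f = f []
cubeSum {suc n} f = cubeSum (λ V → f (false ∷ V)) + cubeSum (λ V → f (true ∷ V))

cubeSum-cong : {f h : Subset n → ℕ} → (∀ V → f V ≡ h V) → cubeSum f ≡ cubeSum h
cubeSum-cong {n = zero}  e = e []
cubeSum-cong {n = suc n} e =
  cong₂ _+_ (cubeSum-cong (e ∘ (false ∷_))) (cubeSum-cong (e ∘ (true ∷_)))

cubeSum-mono : {f h : Subset n → ℕ} → (∀ V → f V ≤ h V) → cubeSum f ≤ cubeSum h
cubeSum-mono {n = zero}  f≤h = f≤h []
cubeSum-mono {n = suc n} f≤h =
  +-mono-≤ (cubeSum-mono (f≤h ∘ (false ∷_))) (cubeSum-mono (f≤h ∘ (true ∷_)))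

cubeSum-+ : (f h : Subset n → ℕ) → cubeSum (λ V → f V + h V) ≡ cubeSum f + cubeSum h
cubeSum-+ {n = zero}  f h = refl
cubeSum-+ {n = suc n} f h =
  trans (cong₂ _+_ (cubeSum-+ (f ∘ (false ∷_)) (h ∘ (false ∷_)))
                   (cubeSum-+ (f ∘ (true ∷_)) (h ∘ (true ∷_))))
        (+-interchange (cubeSum (f ∘ (false ∷_))) _ _ _)

cubeSum-zero : cubeSum {n} (λ _ → 0) ≡ 0
cubeSum-zero {n = zero}  = refl
cubeSum-zero {n = suc n} = cong₂ _+_ (cubeSum-zero {n}) (cubeSum-zero {n})

cubeSum-scale : (c : ℕ) (f : Subset n → ℕ) → cubeSum (λ V → c * f V) ≡ c * cubeSum f
cubeSum-scale {n = zero}  c f = refl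
cubeSum-scale {n = suc n} c f =
  trans (cong₂ _+_ (cubeSum-scale c (f ∘ (false ∷_))) (cubeSum-scale c (f ∘ (true ∷_))))
        (sym (*-distribˡ-+ c _ _))

listSum-cubeSum : (w : E → Subset n → ℕ) (L : List E) →
  listSum (λ x → cubeSum (w x)) L ≡ cubeSum (λ V → listSum (λ x → w x V) L)
listSum-cubeSum {n = n} w []       = sym (cubeSum-zero {n})
listSum-cubeSum w (x ∷ L) =
  trans (cong (cubeSum (w x) +_) (listSum-cubeSum w L))
        (sym (cubeSum-+ (w x) (λ V → listSum (λ y → w y V) L)))

-- Symmetric difference; for V ⊆ A, V ⊕ A is the complement A∖V.
_⊕_ : Subset n → Subset n → Subset n
_⊕_ = zipWith _xor_

_⊆ᵇ_ : Subset n → Subset n → Bool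
[]      ⊆ᵇ []      = true
(v ∷ V) ⊆ᵇ (a ∷ A) = (not v ∨ a) ∧ (V ⊆ᵇ A)

-- Translating by A is a bijection of the cube, so it preserves cube sums.
cubeSum-⊕ : (f : Subset n → ℕ) (A : Subset n) →
            cubeSum f ≡ cubeSum (λ V → f (V ⊕ A))
cubeSum-⊕ f []           = refl
cubeSum-⊕ f (false ∷ A) =
  cong₂ _+_ (cubeSum-⊕ (f ∘ (false ∷_)) A) (cubeSum-⊕ (f ∘ (true ∷_)) A)
cubeSum-⊕ f (true ∷ A)  =
  trans (+-comm (cubeSum (f ∘ (false ∷_))) _)
        (cong₂ _+_ (cubeSum-⊕ (f ∘ (true ∷_)) A) (cubeSum-⊕ (f ∘ (false ∷_)) A))

⊕-involutive : (V A : Subset n) → (V ⊕ A) ⊕ A ≡ V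
⊕-involutive []            []            = refl
⊕-involutive (false ∷ V) (false ∷ A) = cong (false ∷_) (⊕-involutive V A)
⊕-involutive (false ∷ V) (true ∷ A)  = cong (false ∷_) (⊕-involutive V A)
⊕-involutive (true ∷ V)  (false ∷ A) = cong (true ∷_)  (⊕-involutive V A)
⊕-involutive (true ∷ V)  (true ∷ A)  = cong (true ∷_)  (⊕-involutive V A)

⊆ᵇ-⊤ : (V : Subset n) → V ⊆ᵇ ⊤ ≡ true
⊆ᵇ-⊤ []           = refl
⊆ᵇ-⊤ (false ∷ V) = ⊆ᵇ-⊤ V
⊆ᵇ-⊤ (true ∷ V)  = ⊆ᵇ-⊤ V

⊕-⊆ᵇ : (V A : Subset n) → T (V ⊆ᵇ A) → T ((V ⊕ A) ⊆ᵇ A)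
⊕-⊆ᵇ []            []            _   = _
⊕-⊆ᵇ (false ∷ V) (false ∷ A) V⊆A = ⊕-⊆ᵇ V A V⊆A
⊕-⊆ᵇ (false ∷ V) (true ∷ A)  V⊆A = ⊕-⊆ᵇ V A V⊆A
⊕-⊆ᵇ (true ∷ V)  (true ∷ A)  V⊆A = ⊕-⊆ᵇ V A V⊆A

∣V∣+∣V⊕A∣ : (V A : Subset n) → T (V ⊆ᵇ A) → ∣ V ∣ + ∣ V ⊕ A ∣ ≡ ∣ A ∣
∣V∣+∣V⊕A∣ []            []            _   = refl
∣V∣+∣V⊕A∣ (false ∷ V) (false ∷ A) V⊆A = ∣V∣+∣V⊕A∣ V A V⊆A
∣V∣+∣V⊕A∣ (false ∷ V) (true ∷ A)  V⊆A =
  trans (+-suc ∣ V ∣ ∣ V ⊕ A ∣) (cong suc (∣V∣+∣V⊕A∣ V A V⊆A))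
∣V∣+∣V⊕A∣ (true ∷ V)  (true ∷ A)  V⊆A = cong suc (∣V∣+∣V⊕A∣ V A V⊆A)

⊆ᵇ⇒∣∣≤ : (A B : Subset n) → T (A ⊆ᵇ B) → ∣ A ∣ ≤ ∣ B ∣
⊆ᵇ⇒∣∣≤ []            []            _   = z≤n
⊆ᵇ⇒∣∣≤ (false ∷ A) (false ∷ B) A⊆B = ⊆ᵇ⇒∣∣≤ A B A⊆B
⊆ᵇ⇒∣∣≤ (false ∷ A) (true ∷ B)  A⊆B = m≤n⇒m≤1+n (⊆ᵇ⇒∣∣≤ A B A⊆B)
⊆ᵇ⇒∣∣≤ (true ∷ A)  (true ∷ B)  A⊆B = s≤s (⊆ᵇ⇒∣∣≤ A B A⊆B)

⊆ᵇ-same-size : (A B : Subset n) → T (A ⊆ᵇ B) → ∣ A ∣ ≡ ∣ B ∣ → A ≡ B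
⊆ᵇ-same-size []            []            _   _ = refl
⊆ᵇ-same-size (false ∷ A) (false ∷ B) A⊆B e = cong (false ∷_) (⊆ᵇ-same-size A B A⊆B e)
⊆ᵇ-same-size (false ∷ A) (true ∷ B)  A⊆B e =
  ⊥-elim (<⇒≱ (≤-reflexive (sym e)) (⊆ᵇ⇒∣∣≤ A B A⊆B))
⊆ᵇ-same-size (true ∷ A)  (true ∷ B)  A⊆B e =
  cong (true ∷_) (⊆ᵇ-same-size A B A⊆B (suc-injective e))

⊆ᵇ-from-parts : (V A B : Subset n) → T (V ⊆ᵇ A) → T (V ⊆ᵇ B) →
                T ((V ⊕ A) ⊆ᵇ B) → T (A ⊆ᵇ B)
⊆ᵇ-from-parts []            []            []           _   _   _ = _
⊆ᵇ-from-parts (false ∷ V) (false ∷ A) (b ∷ B)    V⊆A V⊆B c =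
  ⊆ᵇ-from-parts V A B V⊆A (∧-right V⊆B) c
⊆ᵇ-from-parts (false ∷ V) (true ∷ A)  (true ∷ B) V⊆A V⊆B c = ⊆ᵇ-from-parts V A B V⊆A V⊆B c
⊆ᵇ-from-parts (true ∷ V)  (true ∷ A)  (true ∷ B) V⊆A V⊆B c = ⊆ᵇ-from-parts V A B V⊆A V⊆B c

⊆ᵇ-∪ˡ : (P X Y : Subset n) → T (P ⊆ᵇ X) → T (P ⊆ᵇ (X ∪ Y))
⊆ᵇ-∪ˡ []            []            []           _   = _
⊆ᵇ-∪ˡ (false ∷ P) (x ∷ X)     (y ∷ Y)    P⊆X = ⊆ᵇ-∪ˡ P X Y P⊆X
⊆ᵇ-∪ˡ (true ∷ P)  (true ∷ X)  (y ∷ Y)    P⊆X = ⊆ᵇ-∪ˡ P X Y P⊆X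

⊆ᵇ-∪ʳ : (P X Y : Subset n) → T (P ⊆ᵇ Y) → T (P ⊆ᵇ (X ∪ Y))
⊆ᵇ-∪ʳ P X Y P⊆Y = subst (λ Z → T (P ⊆ᵇ Z)) (∪-comm Y X) (⊆ᵇ-∪ˡ P Y X P⊆Y)

∪-absorb : (V A Y : Subset n) → T (V ⊆ᵇ A) → T ((V ⊕ A) ⊆ᵇ Y) → Y ∪ A ≡ Y ∪ V
∪-absorb []            []            []           _   _ = refl
∪-absorb (false ∷ V) (false ∷ A) (y ∷ Y)    V⊆A c = cong (_ ∷_) (∪-absorb V A Y V⊆A c)
∪-absorb (false ∷ V) (true ∷ A)  (true ∷ Y) V⊆A c = cong (_ ∷_) (∪-absorb V A Y V⊆A c)
∪-absorb (true ∷ V)  (true ∷ A)  (y ∷ Y)    V⊆A c = cong (_ ∷_) (∪-absorb V A Y V⊆A c)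

-- Two supersets of V whose complements of V both lie in Y are
-- indistinguishable after union with Y: this is how 2-cancellativity fails.
∪-glue : (V A B Y : Subset n) → T (V ⊆ᵇ A) → T (V ⊆ᵇ B) →
         T ((V ⊕ A) ⊆ᵇ Y) → T ((V ⊕ B) ⊆ᵇ Y) → Y ∪ A ≡ Y ∪ B
∪-glue V A B Y V⊆A V⊆B cA cB = trans (∪-absorb V A Y V⊆A cA) (sym (∪-absorb V B Y V⊆B cB))

subsets-of-size : (A : Subset n) (j : ℕ) →
  cubeSum (λ V → bit ((∣ V ∣ ≡ᵇ j) ∧ (V ⊆ᵇ A))) ≡ ∣ A ∣ C j
subsets-of-size [] zero    = refl
subsets-of-size [] (suc j) = refl
subsets-of-size {n = suc n} (false ∷ A) j =
  trans (cong₂ _+_ (subsets-of-size A j) no-new-subsets) (+-identityʳ (∣ A ∣ C j))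
  where
  -- a set containing the new point is not a subset of false ∷ A
  no-new-subsets : cubeSum {n} (λ V → bit ((suc ∣ V ∣ ≡ᵇ j) ∧ false)) ≡ 0
  no-new-subsets = trans (cubeSum-cong {n = n} (λ V → cong bit (∧-zeroʳ (suc ∣ V ∣ ≡ᵇ j))))
                         (cubeSum-zero {n})
subsets-of-size {n = suc n} (true ∷ A) zero =
  cong₂ _+_ (subsets-of-size A zero) (cubeSum-zero {n = n})
subsets-of-size (true ∷ A) (suc j) = begin
  cubeSum (λ V → bit ((∣ V ∣ ≡ᵇ suc j) ∧ (V ⊆ᵇ A)))
    + cubeSum (λ V → bit ((∣ V ∣ ≡ᵇ j) ∧ (V ⊆ᵇ A)))
    ≡⟨ cong₂ _+_ (subsets-of-size A (suc j)) (subsets-of-size A j) ⟩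
  ∣ A ∣ C suc j + ∣ A ∣ C j ≡⟨ +-comm (∣ A ∣ C suc j) _ ⟩
  ∣ A ∣ C j + ∣ A ∣ C suc j ≡⟨ nCk+nC[k+1]≡[n+1]C[k+1] ∣ A ∣ j ⟩
  suc ∣ A ∣ C suc j        ∎
  where open ≡-Reasoning

sets-of-size : (n j : ℕ) → cubeSum {n} (λ V → bit (∣ V ∣ ≡ᵇ j)) ≡ n C j
sets-of-size n j = begin
  cubeSum {n} (λ V → bit (∣ V ∣ ≡ᵇ j))                   ≡⟨ cubeSum-cong inside-⊤ ⟩
  cubeSum {n} (λ V → bit ((∣ V ∣ ≡ᵇ j) ∧ (V ⊆ᵇ ⊤)))     ≡⟨ subsets-of-size (⊤ {n}) j ⟩
  ∣ ⊤ {n} ∣ C j                                          ≡⟨ cong (_C j) (∣⊤∣≡n n) ⟩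
  n C j                                                  ∎
  where
  open ≡-Reasoning
  inside-⊤ : (V : Subset n) → bit (∣ V ∣ ≡ᵇ j) ≡ bit ((∣ V ∣ ≡ᵇ j) ∧ (V ⊆ᵇ ⊤))
  inside-⊤ V = cong bit (sym (trans (cong ((∣ V ∣ ≡ᵇ j) ∧_) (⊆ᵇ-⊤ V)) (∧-identityʳ _)))

module Counting {X : Set} (_≟_ : DecidableEquality X) where

  _≠ᵇ_ : X → X → Bool
  x ≠ᵇ a = not (does (x ≟ a))

  ≠ᵇ⇒≢ : (x a : X) → T (x ≠ᵇ a) → x ≢ a
  ≠ᵇ⇒≢ x a x≠a x≡a with x ≟ a
  ... | yes _   = x≠a
  ... | no x≢a = x≢a x≡a

  without : (X → Bool) → X → X → Bool
  without p a x = p x ∧ (x ≠ᵇ a)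

  without-sound : (p : X → Bool) (a x : X) → T (without p a x) → T (p x) × x ≢ a
  without-sound p a x h = ∧-left h , ≠ᵇ⇒≢ x a (∧-right h)

  count-∈ : (p : X → Bool) {x : X} {L : List X} → x ∈ L → T (p x) → 1 ≤ count p L
  count-∈ p {L = y ∷ L} (here refl) px with p y
  ... | true = s≤s z≤n
  count-∈ p {L = y ∷ L} (there x∈L) px = ≤-trans (count-∈ p x∈L px) (m≤n+m _ (bit (p y)))

  count-witness : (p : X → Bool) (L : List X) → 1 ≤ count p L → Σ X (λ x → x ∈ L × T (p x))
  count-witness p (y ∷ L) pos with p y in py
  ... | true  = y , here refl , subst T (sym py) _
  ... | false with count-witness p L pos
  ...   | x , x∈L , px = x , there x∈L , px

  count-without-absent : (p : X → Bool) (a : X) (L : List X) → All (a ≢_) L →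
                         count p L ≤ count (without p a) L
  count-without-absent p a []       []           = z≤n
  count-without-absent p a (y ∷ L) (a≢y ∷ a∉L) with y ≟ a
  ... | yes y≡a = ⊥-elim (a≢y (sym y≡a))
  ... | no _ rewrite ∧-identityʳ (p y) = +-monoʳ-≤ (bit (p y)) (count-without-absent p a L a∉L)

  count-without : (p : X → Bool) (a : X) (L : List X) → Unique L →
                  count p L ≤ 1 + count (without p a) L
  count-without p a []       _              = z≤n
  count-without p a (y ∷ L) (y∉L ∷ unique) with y ≟ a
  ... | yes refl rewrite ∧-zeroʳ (p y) =
    +-mono-≤ (bit≤1 (p y)) (count-without-absent p y L y∉L)
    where
    bit≤1 : ∀ b → bit b ≤ 1
    bit≤1 true  = ≤-refl
    bit≤1 false = z≤n
  ... | no _ rewrite ∧-identityʳ (p y) = begin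
    bit (p y) + count p L                           ≤⟨ +-monoʳ-≤ (bit (p y)) (count-without p a L unique) ⟩
    bit (p y) + (1 + count (without p a) L)        ≡⟨ +-suc (bit (p y)) _ ⟩
    1 + (bit (p y) + count (without p a) L)        ∎
    where open ≤-Reasoning

  pick : (p : X → Bool) (L : List X) {m : ℕ} → Unique L → suc m ≤ count p L →
         Σ X (λ x → x ∈ L × T (p x) × m ≤ count (without p x) L)
  pick p L unique big with count-witness p L (≤-trans (s≤s z≤n) big)
  ... | x , x∈L , px = x , x∈L , px , ≤-pred (≤-trans big (count-without p x L unique))

  another : (p : X → Bool) (L : List X) {y : X} → Unique L → 2 ≤ count p L →
            Σ X (λ x → x ∈ L × T (p x) × x ≢ y)
  another p L {y} unique two with count-witness (without p y) L
                                   (≤-pred (≤-trans two (count-without p y L unique)))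
  ... | x , x∈L , px≠y = x , x∈L , without-sound p y x px≠y

  record Three (p : X → Bool) (L : List X) : Set where
    field
      a b d       : X
      a∈L         : a ∈ L
      b∈L         : b ∈ L
      d∈L         : d ∈ L
      pa          : T (p a)
      pb          : T (p b)
      pd          : T (p d)
      a≢b         : a ≢ b
      a≢d         : a ≢ d
      b≢d         : b ≢ d

  three : (p : X → Bool) (L : List X) → Unique L → 3 ≤ count p L → Three p L
  three p L unique big with pick p L unique big
  ... | a , a∈L , pa , two with pick (without p a) L unique two
  ... | b , b∈L , pb≠a , one with count-witness (without (without p a) b) L one
  ... | d , d∈L , pd≠a≠b =
    let (pb , b≢a)  = without-sound p a b pb≠a
        (pd≠a , d≢b) = without-sound (without p a) b d pd≠a≠b
        (pd , d≢a)  = without-sound p a d pd≠a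
    in record { a = a ; b = b ; d = d ; a∈L = a∈L ; b∈L = b∈L ; d∈L = d∈L
              ; pa = pa ; pb = pb ; pd = pd
              ; a≢b = ≢-sym b≢a ; a≢d = ≢-sym d≢a ; b≢d = ≢-sym d≢b }

-- share d e is the part of the weight 2 of a complementary pair {V, A∖V} that
-- goes to V when deg V = d and deg (A∖V) = e: a half of degree 1 takes
-- everything from a partner of degree ≥ 3, otherwise the pair splits evenly.
share : ℕ → ℕ → ℕ
share 1 (suc (suc (suc _))) = 2
share (suc (suc (suc _))) 1 = 0
share _                   _ = 1

share-pair : ∀ d e → share d e + share e d ≡ 2
share-pair 0                   0                   = refl
share-pair 0                   1                   = refl
share-pair 0                   2                   = refl
share-pair 0                   (suc (suc (suc e))) = refl
share-pair 1                   0                   = refl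
share-pair 1                   1                   = refl
share-pair 1                   2                   = refl
share-pair 1                   (suc (suc (suc e))) = refl
share-pair 2                   0                   = refl
share-pair 2                   1                   = refl
share-pair 2                   2                   = refl
share-pair 2                   (suc (suc (suc e))) = refl
share-pair (suc (suc (suc d))) 0                   = refl
share-pair (suc (suc (suc d))) 1                   = refl
share-pair (suc (suc (suc d))) 2                   = refl
share-pair (suc (suc (suc d))) (suc (suc (suc e))) = refl

share-lone : ∀ e → share 1 e ≤ 2
share-lone 0                   = s≤s z≤n
share-lone 1                   = s≤s z≤n
share-lone 2                   = s≤s z≤n
share-lone (suc (suc (suc e))) = ≤-refl

share-≤1 : ∀ d e → d ≢ 1 → share d e ≤ 1
share-≤1 0                   e                   _   = ≤-refl
share-≤1 1                   e                   d≢1 = ⊥-elim (d≢1 refl)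
share-≤1 2                   e                   _   = ≤-refl
share-≤1 (suc (suc (suc d))) 0                   _   = ≤-refl
share-≤1 (suc (suc (suc d))) 1                   _   = z≤n
share-≤1 (suc (suc (suc d))) (suc (suc e))       _   = ≤-refl

share-crowded : ∀ d e → share (3 + d) e ≤ bit (not (e ≡ᵇ 1))
share-crowded d 0             = ≤-refl
share-crowded d 1             = z≤n
share-crowded d (suc (suc e)) = ≤-refl

module CancellativeBound {n : ℕ} (K : ℕ) (F : List (Subset n)) (unique : Unique F)
  (uniform : Uniform (K + K) F) (cancellative : TwoCancellative F) where

  open Counting {Subset n} (≡-dec Bool._≟_)

  member-size : {A : Subset n} → A ∈ F → ∣ A ∣ ≡ K + K
  member-size = All.lookup uniform

  deg : Subset n → ℕ
  deg V = count (V ⊆ᵇ_) F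

  -- A ⊇ V is a heavy extension of V when A∖V has degree ≠ 1, i.e. (as A
  -- itself contains A∖V) when A∖V lies in a second member of F.
  heavy : Subset n → Subset n → Bool
  heavy V A = (V ⊆ᵇ A) ∧ not (deg (V ⊕ A) ≡ᵇ 1)

  record Covered (V A : Subset n) : Set where
    field
      member  : A ∈ F
      extends : T (V ⊆ᵇ A)
      cover   : Subset n
      cover∈F : cover ∈ F
      cover≢A : cover ≢ A
      covers  : T ((V ⊕ A) ⊆ᵇ cover)
  open Covered

  heavy⇒covered : {V A : Subset n} → A ∈ F → T (heavy V A) → Covered V A
  heavy⇒covered {V} {A} A∈F h =
    let (X , X∈F , A∖V⊆X , X≢A) = another ((V ⊕ A) ⊆ᵇ_) F unique degree≥2
    in record { member = A∈F ; extends = ∧-left h ; cover = X ; cover∈F = X∈F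
              ; cover≢A = X≢A ; covers = A∖V⊆X }
    where
    degree≥2 : 2 ≤ deg (V ⊕ A)
    degree≥2 = ≢1⇒2≤ (deg (V ⊕ A)) (∧-right h)
                     (count-∈ ((V ⊕ A) ⊆ᵇ_) A∈F (⊕-⊆ᵇ V A (∧-left h)))

  -- The cover of A∖V is not another member B ⊇ V: such a B would contain A
  -- and have the same size.
  cover≢sibling : {V A B : Subset n} (a : Covered V A) → B ∈ F → T (V ⊆ᵇ B) → A ≢ B →
                  cover a ≢ B
  cover≢sibling {V} {A} a B∈F V⊆B A≢B refl =
    A≢B (⊆ᵇ-same-size A _ (⊆ᵇ-from-parts V A _ (extends a) V⊆B (covers a))
                           (trans (member-size (member a)) (sym (member-size B∈F))))

  -- Two heavy extensions A ≠ B of V with different covers X ≠ Y violate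
  -- 2-cancellativity: X ∪ Y ∪ A = X ∪ Y ∪ V = X ∪ Y ∪ B.
  distinct-covers : {V A B : Subset n} (a : Covered V A) (b : Covered V B) → A ≢ B →
                    cover a ≢ cover b → ⊥
  distinct-covers {V} {A} {B} a b A≢B X≢Y =
    cancellative X Y A B (cover∈F a) (cover∈F b) (member a) (member b)
      X≢Y (cover≢A a) (cover≢sibling a (member b) (extends b) A≢B)
      (cover≢sibling b (member a) (extends a) (≢-sym A≢B)) (cover≢A b) A≢B
      (∪-glue V A B (X ∪ Y) (extends a) (extends b) (⊆ᵇ-∪ˡ (V ⊕ A) X Y (covers a))
                                           (⊆ᵇ-∪ʳ (V ⊕ B) X Y (covers b)))
    where
    X Y : Subset n
    X = cover a
    Y = cover b

  -- Three heavy extensions A, B, D of V with one common cover X violate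
  -- 2-cancellativity: X ∪ D ∪ A = X ∪ D ∪ V = X ∪ D ∪ B.
  common-cover : {V A B D : Subset n} (a : Covered V A) (b : Covered V B) (d : Covered V D) →
                 cover b ≡ cover a → cover d ≡ cover a → A ≢ B → A ≢ D → B ≢ D → ⊥
  common-cover {V} {A} {B} {D} a b d b≡a d≡a A≢B A≢D B≢D =
    cancellative X D A B (cover∈F a) (member d) (member a) (member b)
      (λ X≡D → cover≢A d (trans d≡a X≡D)) (cover≢A a) (cover≢sibling a (member b) (extends b) A≢B)
      (≢-sym A≢D) (≢-sym B≢D) A≢B
      (∪-glue V A B (X ∪ D) (extends a) (extends b) (⊆ᵇ-∪ˡ (V ⊕ A) X D (covers a))
              (⊆ᵇ-∪ˡ (V ⊕ B) X D (subst (λ Z → T ((V ⊕ B) ⊆ᵇ Z)) b≡a (covers b))))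
    where
    X : Subset n
    X = cover a

  -- Hence no V has three distinct heavy extensions: two of them have
  -- different covers, or all three share one.
  no-three-covered : {V A B D : Subset n} → Covered V A → Covered V B → Covered V D →
                     A ≢ B → A ≢ D → B ≢ D → ⊥
  no-three-covered a b d A≢B A≢D B≢D
    with ≡-dec Bool._≟_ (cover a) (cover b) | ≡-dec Bool._≟_ (cover a) (cover d)
  ... | no X≢Y   | _        = distinct-covers a b A≢B X≢Y
  ... | yes _    | no X≢Z   = distinct-covers a d A≢D X≢Z
  ... | yes X≡Y  | yes X≡Z  = common-cover a b d (sym X≡Y) (sym X≡Z) A≢B A≢D B≢D

  at-most-two-heavy : (V : Subset n) → count (heavy V) F ≤ 2
  at-most-two-heavy V with count (heavy V) F ≤? 2
  ... | yes ≤2 = ≤2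
  ... | no ≰2 =
    ⊥-elim (no-three-covered (heavy⇒covered {V} a∈L pa) (heavy⇒covered {V} b∈L pb)
                             (heavy⇒covered {V} d∈L pd) a≢b a≢d b≢d)
    where open Three (three (heavy V) F unique (≰⇒> ≰2))

  collected-≤-degree : (V : Subset n) {d : ℕ} (c : ℕ) → (∀ e → share d e ≤ c) →
    listSum (λ A → bit (V ⊆ᵇ A) * share d (deg (V ⊕ A))) F ≤ c * deg V
  collected-≤-degree V {d} c share≤c = begin
    listSum (λ A → bit (V ⊆ᵇ A) * share d (deg (V ⊕ A))) F ≤⟨ listSum-mono term F ⟩
    listSum (λ A → c * bit (V ⊆ᵇ A)) F
      ≡⟨ listSum-scale c (λ A → bit (V ⊆ᵇ A)) F ⟩
    c * deg V                                               ∎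
    where
    open ≤-Reasoning
    term : ∀ A → bit (V ⊆ᵇ A) * share d (deg (V ⊕ A)) ≤ c * bit (V ⊆ᵇ A)
    term A = ≤-trans (*-monoʳ-≤ (bit (V ⊆ᵇ A)) (share≤c (deg (V ⊕ A))))
                     (≤-reflexive (*-comm (bit (V ⊆ᵇ A)) c))

  collected-≤-heavy : (V : Subset n) {d : ℕ} → (∀ e → share d e ≤ bit (not (e ≡ᵇ 1))) →
    listSum (λ A → bit (V ⊆ᵇ A) * share d (deg (V ⊕ A))) F ≤ 2
  collected-≤-heavy V {d} share≤ = ≤-trans (listSum-mono term F) (at-most-two-heavy V)
    where
    term : ∀ A → bit (V ⊆ᵇ A) * share d (deg (V ⊕ A)) ≤ bit (heavy V A)
    term A = ≤-trans (*-monoʳ-≤ (bit (V ⊆ᵇ A)) (share≤ (deg (V ⊕ A))))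
                     (≤-reflexive (bit-∧ (V ⊆ᵇ A) (not (deg (V ⊕ A) ≡ᵇ 1))))

  collected-bound : (V : Subset n) →
    listSum (λ A → bit (V ⊆ᵇ A) * share (deg V) (deg (V ⊕ A))) F ≤ 2
  collected-bound V with deg V in deg≡
  ... | 0 = ≤-trans (collected-≤-degree V {0} 1 (λ e → share-≤1 0 e (λ ())))
                    (≤-trans (≤-reflexive (cong (1 *_) deg≡)) z≤n)
  ... | 1 = ≤-trans (collected-≤-degree V {1} 2 share-lone)
                    (≤-reflexive (cong (2 *_) deg≡))
  ... | 2 = ≤-trans (collected-≤-degree V {2} 1 (λ e → share-≤1 2 e (λ ())))
                    (≤-reflexive (cong (1 *_) deg≡))
  ... | suc (suc (suc d)) = collected-≤-heavy V (share-crowded d)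

  half : Subset n → Subset n → Bool
  half A V = (∣ V ∣ ≡ᵇ K) ∧ (V ⊆ᵇ A)

  weight : Subset n → Subset n → ℕ
  weight A V = bit (half A V) * share (deg V) (deg (V ⊕ A))

  half-complement : {A : Subset n} → ∣ A ∣ ≡ K + K → (V : Subset n) →
                    T (half A V) → T (half A (V ⊕ A))
  half-complement {A} size V h = ∧-intro (≡⇒≡ᵇ ∣ V ⊕ A ∣ K ∣V⊕A∣≡K) (⊕-⊆ᵇ V A V⊆A)
    where
    V⊆A : T (V ⊆ᵇ A)
    V⊆A = ∧-right h
    ∣V⊕A∣≡K : ∣ V ⊕ A ∣ ≡ K
    ∣V⊕A∣≡K = +-cancelˡ-≡ K _ _ (begin
      K + ∣ V ⊕ A ∣       ≡⟨ cong (_+ ∣ V ⊕ A ∣) (sym (≡ᵇ⇒≡ ∣ V ∣ K (∧-left h))) ⟩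
      ∣ V ∣ + ∣ V ⊕ A ∣   ≡⟨ ∣V∣+∣V⊕A∣ V A V⊆A ⟩
      ∣ A ∣               ≡⟨ size ⟩
      K + K               ∎)
      where open ≡-Reasoning

  half-⊕ : {A : Subset n} → ∣ A ∣ ≡ K + K → (V : Subset n) → half A (V ⊕ A) ≡ half A V
  half-⊕ {A} size V =
    T-ext (λ h → subst (T ∘ half A) (⊕-involutive V A) (half-complement size (V ⊕ A) h))
          (half-complement size V)

  weight-pair : {A : Subset n} → ∣ A ∣ ≡ K + K → (V : Subset n) →
                weight A V + weight A (V ⊕ A) ≡ 2 * bit (half A V)
  weight-pair {A} size V = begin
    weight A V + weight A (V ⊕ A)
      ≡⟨ cong₂ (λ h W → b * share d e + bit h * share e (deg W)) (half-⊕ size V) (⊕-involutive V A) ⟩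
    b * share d e + b * share e d   ≡⟨ sym (*-distribˡ-+ b (share d e) (share e d)) ⟩
    b * (share d e + share e d)     ≡⟨ cong (b *_) (share-pair d e) ⟩
    b * 2                           ≡⟨ *-comm b 2 ⟩
    2 * b                           ∎
    where
    open ≡-Reasoning
    b d e : ℕ
    b = bit (half A V)
    d = deg V
    e = deg (V ⊕ A)

  weight-total : {A : Subset n} → ∣ A ∣ ≡ K + K → cubeSum (weight A) ≡ (K + K) C K
  weight-total {A} size = *-cancelˡ-≡ _ _ 2 (begin
    2 * Σw                                         ≡⟨ cong (Σw +_) (+-identityʳ Σw) ⟩
    Σw + Σw                                        ≡⟨ cong (Σw +_) (cubeSum-⊕ (weight A) A) ⟩
    Σw + cubeSum (λ V → weight A (V ⊕ A))          ≡⟨ sym (cubeSum-+ (weight A) _) ⟩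
    cubeSum (λ V → weight A V + weight A (V ⊕ A))  ≡⟨ cubeSum-cong (weight-pair size) ⟩
    cubeSum (λ V → 2 * bit (half A V))             ≡⟨ cubeSum-scale 2 (bit ∘ half A) ⟩
    2 * cubeSum (λ V → bit (half A V))             ≡⟨ cong (2 *_) (subsets-of-size A K) ⟩
    2 * (∣ A ∣ C K)                                 ≡⟨ cong (λ m → 2 * (m C K)) size ⟩
    2 * ((K + K) C K)                               ∎)
    where
    open ≡-Reasoning
    Σw : ℕ
    Σw = cubeSum (weight A)

  received : (V : Subset n) → listSum (λ A → weight A V) F ≤ 2 * bit (∣ V ∣ ≡ᵇ K)
  received V = received-if (∣ V ∣ ≡ᵇ K)
    where
    received-if : (b : Bool) →
      listSum (λ A → bit (b ∧ (V ⊆ᵇ A)) * share (deg V) (deg (V ⊕ A))) F ≤ 2 * bit b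
    received-if false = ≤-reflexive (listSum-zero F)
    received-if true  = collected-bound V

  cancellative-bound : length F * ((K + K) C K) ≤ 2 * (n C K)
  cancellative-bound = begin
    length F * ((K + K) C K)                       ≡⟨ sym (listSum-const F (All.map weight-total uniform)) ⟩
    listSum (λ A → cubeSum (weight A)) F           ≡⟨ listSum-cubeSum weight F ⟩
    cubeSum (λ V → listSum (λ A → weight A V) F)   ≤⟨ cubeSum-mono received ⟩
    cubeSum {n} (λ V → 2 * bit (∣ V ∣ ≡ᵇ K))
      ≡⟨ cubeSum-scale 2 (λ (V : Subset n) → bit (∣ V ∣ ≡ᵇ K)) ⟩
    2 * cubeSum {n} (λ V → bit (∣ V ∣ ≡ᵇ K))       ≡⟨ cong (2 *_) (sets-of-size n K) ⟩
    2 * (n C K)                                    ∎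
    where open ≤-Reasoning

-- Theorem 5, for k + 1 and n + 1 (the bound above with 2K written as K + K).
theorem5 : (k n : ℕ) → (F : List (Subset (suc n))) →
    Unique F → Uniform (2 * suc k) F → TwoCancellative F →
    length F * ((2 * suc k) C (suc k)) ≤ 2 * (suc n C suc k)
theorem5 k n F unique uniform cancellative =
  subst (λ m → length F * (m C suc k) ≤ 2 * (suc n C suc k)) (sym 2K≡K+K)
    (CancellativeBound.cancellative-bound (suc k) F unique
       (subst (λ m → Uniform m F) 2K≡K+K uniform) cancellative)
  where
  2K≡K+K : 2 * suc k ≡ suc k + suc k
  2K≡K+K = cong (suc k +_) (+-identityʳ (suc k))
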